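{- Let $A, B \in \mathcal{C}(G_n)$ be in the same path class. Then $A$ and $B$ are also in the same character class.
   Context: Let $Q_n=\{1,\dots,n\}$ be a set of $n$ yes/no questions; an outcome on $S\subseteq Q_n$ is an element of $\{0,1\}^{|S|}$, and $X_S$ is the set of outcomes on $S$. A preference matrix on $Q_n$ is a $2^n\times n$ 0-1 matrix whose rows are the $2^n$ outcomes, each exactly once, ordered from most to least preferred. For a nonempty proper $S\subset Q_n$ and outcome $x$ on $Q_n-S$, $P^{[Q_n-S,x]}$ is the submatrix formed by the columns in $S$ and rows with outcome $x$ on $Q_n-S$ (in order); $S$ is separable with respect to $P$ if $P^{[Q_n-S,x]}=P^{[Q_n-S,y]}$ for all $x,y\in X_{Q_n-S}$; $\emptyset$ and $Q_n$ are always separable. The character $\mathrm{char}(P)$ is the set of all subsets of $Q_n$ separable with respect to $P$. $\mathcal{C}(G_n)$ is the set of preference matrices generated by Hamiltonian paths in the $n$-dimensional hypercube graph $G_n$ with Gray code labeling, i.e. preference matrices in which consecutive rows differ in exactly one entry. Two characters $C_1,C_2$ are isomorphic if there is a permutation $\sigma\in S_n$ with $C_2=\{\sigma(S):S\in C_1\}$, where $\sigma(S)=\{\sigma(i):i\in S\}$; a character class is an equivalence class of preference matrices under $P_1\sim P_2$ iff $\mathrm{char}(P_1)$ and $\mathrm{char}(P_2)$ are isomorphic. Let $H_n$ be the hyperoctahedral group of $n\times n$ matrices with entries in $\{0,\pm1\}$ having exactly one nonzero entry in each row and column. For a matrix $P$ with entries in $\{0,\pm 1\}$, let $\overline{P}$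 be obtained by replacing each $0$ by $-1$ and each $-1$ by $0$. $H_n$ acts on $\mathcal{C}(G_n)$ on the right by $P\cdot M=\overline{\overline{P}M}$ (permuting columns and complementing some of them); the path classes of $G_n$ are the orbits of this action. -}

module Defs where

open import Data.Nat using (ℕ; zero; suc; _^_)
open import Data.Bool using (Bool; true; false; _∧_; if_then_else_)
open import Data.Bool.Properties using () renaming (_≟_ to _≟ᵇ_)
open import Data.Vec using (Vec; []; _∷_; lookup; tabulate; map; zipWith; foldr)
open import Data.List using (List; filter) renaming ([] to []ₗ; _∷_ to _∷ₗ_; map to mapₗ)
open import Data.List.Relation.Unary.Unique.Propositional using (Unique)
open import Data.List.Relation.Unary.Linked using (Linked)
open import Data.List.Membership.Propositional using () renaming (_∈_ to _∈ₗ_)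
open import Data.Fin using (Fin)
open import Data.Fin.Subset using (Subset)
open import Data.Fin.Permutation using (Permutation′; _⟨$⟩ˡ_)
open import Data.Integer using (ℤ; +_; -[1+_]; _+_; _*_)
open import Data.Product using (Σ; ∃; ∃-syntax; _×_; _,_)
open import Relation.Binary.PropositionalEquality using (_≡_; _≢_)
open import Relation.Nullary using (does)
open import Function.Bundles using (_⇔_)

-- Outcomes on Q_n = {1..n} (indexed by Fin n); 1 = true, 0 = false.
Outcome : ℕ → Set
Outcome n = Vec Bool n

hamming : ∀ {n} → Outcome n → Outcome n → ℕ
hamming [] [] = 0
hamming (a ∷ x) (b ∷ y) = if does (a ≟ᵇ b) then hamming x y else suc (hamming x y)

-- A preference matrix on Q_n: its list of rows (most to least preferred),
-- each of the 2^n outcomes occurring exactly once.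
record PrefMatrix (n : ℕ) : Set where
  field
    rows     : List (Outcome n)
    distinct : Unique rows
    complete : ∀ (x : Outcome n) → x ∈ₗ rows
open PrefMatrix public

IsGray : ∀ {n} → PrefMatrix n → Set
IsGray P = Linked (λ r s → hamming r s ≡ 1) (rows P)

agreeOff : ∀ {n} → Subset n → Outcome n → Outcome n → Bool
agreeOff [] [] [] = true
agreeOff (true ∷ S) (_ ∷ x) (_ ∷ r) = agreeOff S x r
agreeOff (false ∷ S) (a ∷ x) (b ∷ r) = does (a ≟ᵇ b) ∧ agreeOff S x r

restrict : ∀ {n} → Subset n → Outcome n → List Bool
restrict [] [] = []ₗ
restrict (true ∷ S) (a ∷ r) = a ∷ₗ restrict S r
restrict (false ∷ S) (_ ∷ r) = restrict S r

-- P^{[Q_n - S, x]}, where the outcome on Q_n - S is given as the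
-- restriction of a full outcome x (its entries on S are ignored).
subMatrix : ∀ {n} → PrefMatrix n → Subset n → Outcome n → List (List Bool)
subMatrix P S x = mapₗ (restrict S) (filter (λ r → agreeOff S x r ≟ᵇ true) (rows P))

Separable : ∀ {n} → PrefMatrix n → Subset n → Set
Separable {n} P S = ∀ (x y : Outcome n) → subMatrix P S x ≡ subMatrix P S y

image : ∀ {n} → Permutation′ n → Subset n → Subset n
image σ S = tabulate (λ j → lookup S (σ ⟨$⟩ˡ j))

CharIso : ∀ {n} → PrefMatrix n → PrefMatrix n → Set
CharIso {n} P₁ P₂ = ∃[ σ ] (∀ (T : Subset n) → Separable P₂ T ⇔ (∃[ S ] (Separable P₁ S × T ≡ image σ S)))

SameCharClass : ∀ {n} → PrefMatrix n → PrefMatrix n → Set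
SameCharClass = CharIso

Matrix : ℕ → Set
Matrix n = Vec (Vec ℤ n) n

data Entry : ℤ → Set where
  e0  : Entry (+ 0)
  e1  : Entry (+ 1)
  e-1 : Entry -[1+ 0 ]

ExactlyOneNonzero : ∀ {n} → Vec ℤ n → Set
ExactlyOneNonzero {n} v = ∃[ k ] (lookup v k ≢ + 0 × (∀ (k' : Fin n) → k' ≢ k → lookup v k' ≡ + 0))

column : ∀ {n} → Matrix n → Fin n → Vec ℤ n
column M j = map (λ row → lookup row j) M

InH : ∀ {n} → Matrix n → Set
InH {n} M = (∀ (i j : Fin n) → Entry (lookup (lookup M i) j))
          × (∀ (i : Fin n) → ExactlyOneNonzero (lookup M i))
          × (∀ (j : Fin n) → ExactlyOneNonzero (column M j))

toℤ : ∀ {n} → Outcome n → Vec ℤ n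
toℤ = map (λ b → if b then + 1 else + 0)

barℤ : ℤ → ℤ
barℤ (+ 0) = -[1+ 0 ]
barℤ -[1+ 0 ] = + 0
barℤ z = z

bar : ∀ {n} → Vec ℤ n → Vec ℤ n
bar = map barℤ

vecMat : ∀ {n} → Vec ℤ n → Matrix n → Vec ℤ n
vecMat {n} v M = tabulate (λ j → foldr (λ _ → ℤ) _+_ (+ 0) (zipWith _*_ v (column M j)))

-- a row of P·M = bar(bar(P) M)
actRow : ∀ {n} → Matrix n → Outcome n → Vec ℤ n
actRow M r = bar (vecMat (bar (toℤ r)) M)

ActsTo : ∀ {n} → PrefMatrix n → Matrix n → PrefMatrix n → Set
ActsTo A M B = mapₗ toℤ (rows B) ≡ mapₗ (actRow M) (rows A)

SamePathClass : ∀ {n} → PrefMatrix n → PrefMatrix n → Set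
SamePathClass A B = ∃[ M ] (InH M × ActsTo A M B)

{-# OPTIONS --safe #-}
-- If column j of M ∈ H_n has its nonzero entry in row σ⁻¹ j, then every row r of A·M is the
-- signed relabelling j ↦ r(σ⁻¹ j) xor [M(σ⁻¹ j, j) = -1] of r.  Complementing a column changes
-- neither which rows agree off a set nor whether two rows agree on it, so the submatrix of A·M
-- on σ(S) selected by a relabelled outcome is a fixed recoding of A^{[Q_n - S, x]}; hence S is
-- separable for A iff σ(S) is separable for A·M.
module Submission where

open import Defs
open import Data.Nat using (ℕ)
open import Data.Bool using (Bool; true; false; _xor_; if_then_else_)
open import Data.Bool.Properties using (xor-assoc; xor-same; xor-identityʳ) renaming (_≟_ to _≟ᵇ_)
open import Data.Vec using (Vec; []; _∷_; lookup; tabulate; zipWith; foldr)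
open import Data.Vec.Properties using (lookup∘tabulate; lookup-map; ∷-injective)
open import Data.Vec.Relation.Binary.Pointwise.Extensional using (ext; Pointwise-≡⇒≡)
open import Data.List using (List; filter) renaming ([] to []ₗ; _∷_ to _∷ₗ_; map to mapₗ)
import Data.List.Properties as List
open import Data.Fin using (Fin; zero; suc; _≟_)
open import Data.Fin.Properties using (suc-injective)
open import Data.Fin.Subset using (Subset)
open import Data.Fin.Permutation using (Permutation′; _⟨$⟩ˡ_; _⟨$⟩ʳ_; permutation; flip; inverseˡ; inverseʳ)
open import Data.Integer using (ℤ; +_; -[1+_]; _+_; _*_)
open import Data.Integer.Properties using (*-zeroʳ; +-identityˡ; +-identityʳ)
open import Data.Product using (∃-syntax; _×_; _,_; proj₁; proj₂)
open import Data.Empty using (⊥-elim)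
open import Function using (_∘_)
open import Function.Bundles using (_⇔_; mk⇔; module Equivalence)
open import Relation.Binary.PropositionalEquality
open import Relation.Nullary using (does; yes; no)
open import Relation.Unary using (Decidable; _≐_)

xor-cancelʳ : ∀ a b → (a xor b) xor b ≡ a
xor-cancelʳ a b = trans (xor-assoc a b b) (trans (cong (a xor_) (xor-same b)) (xor-identityʳ a))

filter-map : ∀ {A B : Set} {P : B → Set} (P? : Decidable P) (f : A → B) (xs : List A)
           → filter P? (mapₗ f xs) ≡ mapₗ f (filter (P? ∘ f) xs)
filter-map P? f []ₗ = refl
filter-map P? f (x ∷ₗ xs) with does (P? (f x))
... | true  = cong (f x ∷ₗ_) (filter-map P? f xs)
... | false = filter-map P? f xs

map-≡-transfer : ∀ {A B C : Set} (f : A → B) (g : A → C) → (∀ {a b} → f a ≡ f b → g a ≡ g b)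
               → ∀ {xs ys} → mapₗ f xs ≡ mapₗ f ys → mapₗ g xs ≡ mapₗ g ys
map-≡-transfer f g f≡⇒g≡ {[]ₗ}     {[]ₗ}     _  = refl
map-≡-transfer f g f≡⇒g≡ {x ∷ₗ xs} {y ∷ₗ ys} eq =
  cong₂ _∷ₗ_ (f≡⇒g≡ (List.∷-injectiveˡ eq)) (map-≡-transfer f g f≡⇒g≡ (List.∷-injectiveʳ eq))

EqualWhere : ∀ {n} → Bool → Subset n → Outcome n → Outcome n → Set
EqualWhere b S r r′ = ∀ i → lookup S i ≡ b → lookup r i ≡ lookup r′ i

restrict-≡⇔ : ∀ {n} (S : Subset n) (r r′ : Outcome n) → restrict S r ≡ restrict S r′ ⇔ EqualWhere true S r r′
restrict-≡⇔ S r r′ = mk⇔ (to S r r′) (from S r r′)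
  where
  to : ∀ {n} (S : Subset n) (r r′ : Outcome n) → restrict S r ≡ restrict S r′ → EqualWhere true S r r′
  to (true  ∷ S) (a ∷ r) (b ∷ r′) eq zero    _  = List.∷-injectiveˡ eq
  to (true  ∷ S) (a ∷ r) (b ∷ r′) eq (suc i) Si = to S r r′ (List.∷-injectiveʳ eq) i Si
  to (false ∷ S) (a ∷ r) (b ∷ r′) eq (suc i) Si = to S r r′ eq i Si
  from : ∀ {n} (S : Subset n) (r r′ : Outcome n) → EqualWhere true S r r′ → restrict S r ≡ restrict S r′
  from []          []      []       _  = refl
  from (true  ∷ S) (a ∷ r) (b ∷ r′) eq = cong₂ _∷ₗ_ (eq zero refl) (from S r r′ (eq ∘ suc))
  from (false ∷ S) (a ∷ r) (b ∷ r′) eq = from S r r′ (eq ∘ suc)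

agreeOff≡true⇔ : ∀ {n} (S : Subset n) (x r : Outcome n) → agreeOff S x r ≡ true ⇔ EqualWhere false S x r
agreeOff≡true⇔ S x r = mk⇔ (to S x r) (from S x r)
  where
  to : ∀ {n} (S : Subset n) (x r : Outcome n) → agreeOff S x r ≡ true → EqualWhere false S x r
  to (true  ∷ S) (a ∷ x) (b ∷ r) h (suc i) Si = to S x r h i Si
  to (false ∷ S) (a ∷ x) (b ∷ r) h i       Si with a ≟ᵇ b
  to (false ∷ S) (a ∷ x) (b ∷ r) h zero    _  | yes a≡b = a≡b
  to (false ∷ S) (a ∷ x) (b ∷ r) h (suc i) Si | yes _   = to S x r h i Si
  from : ∀ {n} (S : Subset n) (x r : Outcome n) → EqualWhere false S x r → agreeOff S x r ≡ true
  from []          []      []      _  = refl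
  from (true  ∷ S) (a ∷ x) (b ∷ r) eq = from S x r (eq ∘ suc)
  from (false ∷ S) (a ∷ x) (b ∷ r) eq with a ≟ᵇ b
  ... | yes _   = from S x r (eq ∘ suc)
  ... | no  a≢b = ⊥-elim (a≢b (eq zero refl))

relabel : ∀ {n} → Permutation′ n → (Fin n → Bool) → Outcome n → Outcome n
relabel σ c r = tabulate (λ j → lookup r (σ ⟨$⟩ˡ j) xor c j)

lookup-relabel : ∀ {n} (σ : Permutation′ n) c (r : Outcome n) j
               → lookup (relabel σ c r) j ≡ lookup r (σ ⟨$⟩ˡ j) xor c j
lookup-relabel σ c r = lookup∘tabulate _

relabel-inverseˡ : ∀ {n} (σ : Permutation′ n) (c c′ : Fin n → Bool) → (∀ i → c′ i ≡ c (σ ⟨$⟩ʳ i))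
                → ∀ r → relabel (flip σ) c′ (relabel σ c r) ≡ r
relabel-inverseˡ σ c c′ c′≡ r = Pointwise-≡⇒≡ (ext λ i → begin
  lookup (relabel (flip σ) c′ (relabel σ c r)) i             ≡⟨ lookup-relabel (flip σ) c′ (relabel σ c r) i ⟩
  lookup (relabel σ c r) (σ ⟨$⟩ʳ i) xor c′ i                ≡⟨ cong₂ _xor_ (lookup-relabel σ c r _) (c′≡ i) ⟩
  (lookup r (σ ⟨$⟩ˡ (σ ⟨$⟩ʳ i)) xor c (σ ⟨$⟩ʳ i)) xor c (σ ⟨$⟩ʳ i) ≡⟨ xor-cancelʳ _ _ ⟩
  lookup r (σ ⟨$⟩ˡ (σ ⟨$⟩ʳ i))                              ≡⟨ cong (lookup r) (inverseˡ σ) ⟩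
  lookup r i                                                ∎)
  where open ≡-Reasoning

flipSigns : ∀ {n} → Permutation′ n → (Fin n → Bool) → Fin n → Bool
flipSigns σ c = c ∘ (σ ⟨$⟩ʳ_)

relabel-inverseʳ : ∀ {n} (σ : Permutation′ n) c x → relabel σ c (relabel (flip σ) (flipSigns σ c) x) ≡ x
relabel-inverseʳ σ c = relabel-inverseˡ (flip σ) (flipSigns σ c) c (λ _ → sym (cong c (inverseʳ σ)))

image-image-flip : ∀ {n} (σ : Permutation′ n) (T : Subset n) → image σ (image (flip σ) T) ≡ T
image-image-flip σ T = Pointwise-≡⇒≡ (ext λ j →
  trans (lookup∘tabulate _ j) (trans (lookup∘tabulate _ (σ ⟨$⟩ˡ j)) (cong (lookup T) (inverseʳ σ))))

equalWhere-relabel : ∀ {n} (σ : Permutation′ n) c b S (r r′ : Outcome n)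
                   → EqualWhere b (image σ S) (relabel σ c r) (relabel σ c r′) ⇔ EqualWhere b S r r′
equalWhere-relabel σ c b S r r′ = mk⇔ to from
  where
  image-at : ∀ j → lookup (image σ S) j ≡ lookup S (σ ⟨$⟩ˡ j)
  image-at = lookup∘tabulate _
  to : EqualWhere b (image σ S) (relabel σ c r) (relabel σ c r′) → EqualWhere b S r r′
  to eq i Si = begin
    lookup r i                                                    ≡⟨ cong (lookup r) (inverseˡ σ) ⟨
    lookup r (σ ⟨$⟩ˡ (σ ⟨$⟩ʳ i))                                  ≡⟨ xor-cancelʳ _ _ ⟨
    (lookup r (σ ⟨$⟩ˡ (σ ⟨$⟩ʳ i)) xor c′) xor c′                  ≡⟨ cong (_xor c′) relabelled-equal ⟩
    (lookup r′ (σ ⟨$⟩ˡ (σ ⟨$⟩ʳ i)) xor c′) xor c′                 ≡⟨ xor-cancelʳ _ _ ⟩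
    lookup r′ (σ ⟨$⟩ˡ (σ ⟨$⟩ʳ i))                                 ≡⟨ cong (lookup r′) (inverseˡ σ) ⟩
    lookup r′ i                                                   ∎
    where
    open ≡-Reasoning
    c′ : Bool
    c′ = c (σ ⟨$⟩ʳ i)
    relabelled-equal : lookup r (σ ⟨$⟩ˡ (σ ⟨$⟩ʳ i)) xor c′ ≡ lookup r′ (σ ⟨$⟩ˡ (σ ⟨$⟩ʳ i)) xor c′
    relabelled-equal = trans (sym (lookup-relabel σ c r _))
      (trans (eq _ (trans (image-at _) (trans (cong (lookup S) (inverseˡ σ)) Si))) (lookup-relabel σ c r′ _))
  from : EqualWhere b S r r′ → EqualWhere b (image σ S) (relabel σ c r) (relabel σ c r′)
  from eq j Tj = trans (lookup-relabel σ c r j)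
    (trans (cong (_xor c j) (eq _ (trans (sym (image-at j)) Tj))) (sym (lookup-relabel σ c r′ j)))

rows-relabel-flip : ∀ {n} (σ : Permutation′ n) c (P Q : PrefMatrix n) → rows Q ≡ mapₗ (relabel σ c) (rows P)
                  → rows P ≡ mapₗ (relabel (flip σ) (flipSigns σ c)) (rows Q)
rows-relabel-flip σ c P Q Q≡ = begin
  rows P                                                          ≡⟨ List.map-id (rows P) ⟨
  mapₗ (λ r → r) (rows P)                                         ≡⟨ List.map-cong (relabel-inverseˡ σ c _ (λ _ → refl)) (rows P) ⟨
  mapₗ (relabel (flip σ) (flipSigns σ c) ∘ relabel σ c) (rows P)   ≡⟨ List.map-∘ (rows P) ⟩
  mapₗ (relabel (flip σ) (flipSigns σ c)) (mapₗ (relabel σ c) (rows P)) ≡⟨ cong (mapₗ _) Q≡ ⟨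
  mapₗ (relabel (flip σ) (flipSigns σ c)) (rows Q)                 ∎
  where open ≡-Reasoning

agreeOff-relabel : ∀ {n} (σ : Permutation′ n) c S (x r : Outcome n)
                 → agreeOff (image σ S) (relabel σ c x) (relabel σ c r) ≡ true ⇔ agreeOff S x r ≡ true
agreeOff-relabel σ c S x r = mk⇔
  (from (agreeOff≡true⇔ S x r) ∘ to (equalWhere-relabel σ c false S x r) ∘ to relabelled)
  (from relabelled ∘ from (equalWhere-relabel σ c false S x r) ∘ to (agreeOff≡true⇔ S x r))
  where
  open Equivalence
  relabelled : agreeOff (image σ S) (relabel σ c x) (relabel σ c r) ≡ true
             ⇔ EqualWhere false (image σ S) (relabel σ c x) (relabel σ c r)
  relabelled = agreeOff≡true⇔ (image σ S) (relabel σ c x) (relabel σ c r)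

subMatrix-relabel : ∀ {n} (σ : Permutation′ n) c (P Q : PrefMatrix n) → rows Q ≡ mapₗ (relabel σ c) (rows P)
                  → ∀ S x → subMatrix Q (image σ S) (relabel σ c x)
                            ≡ mapₗ (restrict (image σ S) ∘ relabel σ c) (filter (λ r → agreeOff S x r ≟ᵇ true) (rows P))
subMatrix-relabel σ c P Q Q≡ S x = begin
  mapₗ (restrict T) (filter agrees (rows Q))
    ≡⟨ cong (mapₗ (restrict T) ∘ filter agrees) Q≡ ⟩
  mapₗ (restrict T) (filter agrees (mapₗ (relabel σ c) (rows P)))
    ≡⟨ cong (mapₗ (restrict T)) (filter-map agrees (relabel σ c) (rows P)) ⟩
  mapₗ (restrict T) (mapₗ (relabel σ c) (filter (agrees ∘ relabel σ c) (rows P)))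
    ≡⟨ List.map-∘ _ ⟨
  mapₗ (restrict T ∘ relabel σ c) (filter (agrees ∘ relabel σ c) (rows P))
    ≡⟨ cong (mapₗ _) (List.filter-≐ _ _ agrees≐ (rows P)) ⟩
  mapₗ (restrict T ∘ relabel σ c) (filter (λ r → agreeOff S x r ≟ᵇ true) (rows P)) ∎
  where
  open ≡-Reasoning
  T : Subset _
  T = image σ S
  agrees : Decidable (λ r → agreeOff T (relabel σ c x) r ≡ true)
  agrees r = agreeOff T (relabel σ c x) r ≟ᵇ true
  agrees≐ : (λ r → agreeOff T (relabel σ c x) (relabel σ c r) ≡ true) ≐ (λ r → agreeOff S x r ≡ true)
  agrees≐ = (λ {r} → Equivalence.to (agreeOff-relabel σ c S x r)) , (λ {r} → Equivalence.from (agreeOff-relabel σ c S x r))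

separable-relabel : ∀ {n} (σ : Permutation′ n) c (P Q : PrefMatrix n) → rows Q ≡ mapₗ (relabel σ c) (rows P)
                  → ∀ S → Separable P S → Separable Q (image σ S)
separable-relabel σ c P Q Q≡ S sepS x y = begin
  subMatrix Q T x
    ≡⟨ cong (subMatrix Q T) (relabel-inverseʳ σ c x) ⟨
  subMatrix Q T (relabel σ c x₀)
    ≡⟨ subMatrix-relabel σ c P Q Q≡ S x₀ ⟩
  mapₗ (restrict T ∘ relabel σ c) (rowsAgreeing x₀)
    ≡⟨ map-≡-transfer (restrict S) (restrict T ∘ relabel σ c) restrict-relabel (sepS x₀ y₀) ⟩
  mapₗ (restrict T ∘ relabel σ c) (rowsAgreeing y₀)
    ≡⟨ subMatrix-relabel σ c P Q Q≡ S y₀ ⟨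
  subMatrix Q T (relabel σ c y₀)
    ≡⟨ cong (subMatrix Q T) (relabel-inverseʳ σ c y) ⟩
  subMatrix Q T y ∎
  where
  open ≡-Reasoning
  open Equivalence
  T : Subset _
  T = image σ S
  x₀ y₀ : Outcome _
  x₀ = relabel (flip σ) (flipSigns σ c) x
  y₀ = relabel (flip σ) (flipSigns σ c) y
  rowsAgreeing : Outcome _ → List (Outcome _)
  rowsAgreeing z = filter (λ r → agreeOff S z r ≟ᵇ true) (rows P)
  restrict-relabel : ∀ {r r′} → restrict S r ≡ restrict S r′ → restrict T (relabel σ c r) ≡ restrict T (relabel σ c r′)
  restrict-relabel {r} {r′} = from (restrict-≡⇔ T _ _) ∘ from (equalWhere-relabel σ c true S r r′) ∘ to (restrict-≡⇔ S r r′)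

bitℤ : Bool → ℤ
bitℤ b = if b then + 1 else + 0

bitℤ-injective : ∀ {a b} → bitℤ a ≡ bitℤ b → a ≡ b
bitℤ-injective {true}  {true}  _ = refl
bitℤ-injective {false} {false} _ = refl

toℤ-injective : ∀ {n} {r r′ : Outcome n} → toℤ r ≡ toℤ r′ → r ≡ r′
toℤ-injective {r = []}    {[]}      _  = refl
toℤ-injective {r = a ∷ r} {b ∷ r′} eq =
  cong₂ _∷_ (bitℤ-injective (proj₁ (∷-injective eq))) (toℤ-injective (proj₂ (∷-injective eq)))

isMinusOne : ℤ → Bool
isMinusOne -[1+ 0 ] = true
isMinusOne _        = false

bar-*-bar-unit : ∀ {z} → Entry z → z ≢ + 0 → ∀ b → barℤ (barℤ (bitℤ b) * z) ≡ bitℤ (b xor isMinusOne z)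
bar-*-bar-unit e0  z≢0 b     = ⊥-elim (z≢0 refl)
bar-*-bar-unit e1  _   true  = refl
bar-*-bar-unit e1  _   false = refl
bar-*-bar-unit e-1 _   true  = refl
bar-*-bar-unit e-1 _   false = refl

dot : ∀ {n} → Vec ℤ n → Vec ℤ n → ℤ
dot u w = foldr (λ _ → ℤ) _+_ (+ 0) (zipWith _*_ u w)

dot-zeroʳ : ∀ {n} (u w : Vec ℤ n) → (∀ k → lookup w k ≡ + 0) → dot u w ≡ + 0
dot-zeroʳ []      []      _     = refl
dot-zeroʳ (a ∷ u) (b ∷ w) w≡0 rewrite w≡0 zero | *-zeroʳ a = trans (+-identityˡ _) (dot-zeroʳ u w (w≡0 ∘ suc))

dot-single : ∀ {n} (u w : Vec ℤ n) k → (∀ k′ → k′ ≢ k → lookup w k′ ≡ + 0) → dot u w ≡ lookup u k * lookup w k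
dot-single (a ∷ u) (b ∷ w) zero    w≡0 rewrite dot-zeroʳ u w (λ k′ → w≡0 (suc k′) λ ()) = +-identityʳ (a * b)
dot-single (a ∷ u) (b ∷ w) (suc k) w≡0 rewrite w≡0 zero (λ ()) | *-zeroʳ a =
  trans (+-identityˡ _) (dot-single u w k (λ k′ k′≢k → w≡0 (suc k′) (k′≢k ∘ suc-injective)))

nonzero-position : ∀ {n} (v : Vec ℤ n) (one : ExactlyOneNonzero v) {k} → lookup v k ≢ + 0 → proj₁ one ≡ k
nonzero-position v (k₀ , _ , zero-elsewhere) {k} vₖ≢0 with k ≟ k₀
... | yes k≡k₀ = sym k≡k₀
... | no  k≢k₀ = ⊥-elim (vₖ≢0 (zero-elsewhere k k≢k₀))

module Hyperoctahedral {n} {M : Matrix n} (M∈H : InH M) where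

  entries : ∀ i j → Entry (lookup (lookup M i) j)
  entries = proj₁ M∈H

  rowHasOne : ∀ i → ExactlyOneNonzero (lookup M i)
  rowHasOne = proj₁ (proj₂ M∈H)

  columnHasOne : ∀ j → ExactlyOneNonzero (column M j)
  columnHasOne = proj₂ (proj₂ M∈H)

  rowOf : Fin n → Fin n
  rowOf j = proj₁ (columnHasOne j)

  columnOf : Fin n → Fin n
  columnOf i = proj₁ (rowHasOne i)

  lookup-column : ∀ j i → lookup (column M j) i ≡ lookup (lookup M i) j
  lookup-column j i = lookup-map i (λ row → lookup row j) M

  pivot≢0 : ∀ j → lookup (lookup M (rowOf j)) j ≢ + 0
  pivot≢0 j = proj₁ (proj₂ (columnHasOne j)) ∘ trans (lookup-column j (rowOf j))

  columnOf-rowOf : ∀ j → columnOf (rowOf j) ≡ j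
  columnOf-rowOf j = nonzero-position (lookup M (rowOf j)) (rowHasOne (rowOf j)) (pivot≢0 j)

  rowOf-columnOf : ∀ i → rowOf (columnOf i) ≡ i
  rowOf-columnOf i = nonzero-position (column M (columnOf i)) (columnHasOne (columnOf i))
    (proj₁ (proj₂ (rowHasOne i)) ∘ trans (sym (lookup-column (columnOf i) i)))

  columnPermutation : Permutation′ n
  columnPermutation = permutation columnOf rowOf columnOf-rowOf rowOf-columnOf

  columnSigns : Fin n → Bool
  columnSigns j = isMinusOne (lookup (lookup M (rowOf j)) j)

  actRow≡relabel : ∀ r → actRow M r ≡ toℤ (relabel columnPermutation columnSigns r)
  actRow≡relabel r = Pointwise-≡⇒≡ (ext λ j → begin
    lookup (actRow M r) j
      ≡⟨ lookup-map j barℤ (vecMat (bar (toℤ r)) M) ⟩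
    barℤ (lookup (vecMat (bar (toℤ r)) M) j)
      ≡⟨ cong barℤ (lookup∘tabulate _ j) ⟩
    barℤ (dot (bar (toℤ r)) (column M j))
      ≡⟨ cong barℤ (dot-single (bar (toℤ r)) (column M j) (rowOf j) (proj₂ (proj₂ (columnHasOne j)))) ⟩
    barℤ (lookup (bar (toℤ r)) (rowOf j) * lookup (column M j) (rowOf j))
      ≡⟨ cong₂ (λ u v → barℤ (u * v)) (trans (lookup-map (rowOf j) barℤ (toℤ r)) (cong barℤ (lookup-map (rowOf j) bitℤ r)))
                                       (lookup-column j (rowOf j)) ⟩
    barℤ (barℤ (bitℤ (lookup r (rowOf j))) * lookup (lookup M (rowOf j)) j)
      ≡⟨ bar-*-bar-unit (entries (rowOf j) j) (pivot≢0 j) (lookup r (rowOf j)) ⟩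
    bitℤ (lookup r (rowOf j) xor columnSigns j)
      ≡⟨ cong bitℤ (lookup-relabel columnPermutation columnSigns r j) ⟨
    bitℤ (lookup (relabel columnPermutation columnSigns r) j)
      ≡⟨ lookup-map j bitℤ (relabel columnPermutation columnSigns r) ⟨
    lookup (toℤ (relabel columnPermutation columnSigns r)) j ∎)
    where open ≡-Reasoning

  rows-relabel : ∀ (A B : PrefMatrix n) → ActsTo A M B → rows B ≡ mapₗ (relabel columnPermutation columnSigns) (rows A)
  rows-relabel A B A·M≡B = List.map-injective toℤ-injective
    (trans A·M≡B (trans (List.map-cong actRow≡relabel (rows A)) (List.map-∘ (rows A))))

theorem1 : ∀ (n : ℕ) (A B : PrefMatrix n) → IsGray A → IsGray B
    → SamePathClass A B → SameCharClass A B
theorem1 n A B _ _ (M , M∈H , A·M≡B) = σ , λ T → mk⇔ (reflect T) transport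
  where
  open Hyperoctahedral {M = M} M∈H
  σ : Permutation′ n
  σ = columnPermutation
  B≡ : rows B ≡ mapₗ (relabel σ columnSigns) (rows A)
  B≡ = rows-relabel A B A·M≡B
  reflect : ∀ T → Separable B T → ∃[ S ] (Separable A S × T ≡ image σ S)
  reflect T sepT = image (flip σ) T
                 , separable-relabel (flip σ) _ B A (rows-relabel-flip σ columnSigns A B B≡) T sepT
                 , sym (image-image-flip σ T)
  transport : ∀ {T} → ∃[ S ] (Separable A S × T ≡ image σ S) → Separable B T
  transport (S , sepS , refl) = separable-relabel σ columnSigns A B B≡ S sepS
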